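{- The variety $\mathsf{ROL}$ of residuated ortholattices is $1$-regular: for every residuated ortholattice $\mathbf A$ and all congruences $\theta,\psi$ of $\mathbf A$, if $[1]_\theta=[1]_\psi$ then $\theta=\psi$.
   Context: A residuated ortholattice is an algebra $(A,\wedge,\vee,\neg,\backslash,0,1)$ where $(A,\wedge,\vee,0,1)$ is a bounded lattice, $\neg$ is an order-reversing involution, and $x\cdot y\le z\iff y\le x\backslash z$ for all $x,y,z$, where $x\cdot y:=x\wedge(\neg x\vee y)$. $[a]_\theta$ denotes the $\theta$-class of $a$. -}

module Defs where

open import Level using (Level; _⊔_; suc)
open import Relation.Binary.PropositionalEquality using (_≡_)
open import Relation.Binary.Core using (Rel)
open import Relation.Binary.Structures using (IsEquivalence)
open import Algebra.Core using (Op₁; Op₂)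
import Algebra.Lattice.Structures as LS
open import Data.Product using (_×_)
open import Function.Bundles using (_⇔_)

record ResiduatedOrtholattice (a : Level) : Set (suc a) where
  infixr 7 _∧_
  infixr 6 _∨_
  infix 4 _≤_
  field
    Carrier : Set a
    _∧_ _∨_ _\\_ : Op₂ Carrier
    ¬_ : Op₁ Carrier
    𝟘 𝟙 : Carrier
    isLattice : LS.IsLattice (_≡_ {A = Carrier}) _∨_ _∧_

  _≤_ : Carrier → Carrier → Set a
  x ≤ y = x ∧ y ≡ x

  _·_ : Carrier → Carrier → Carrier
  x · y = x ∧ (¬ x ∨ y)

  field
    𝟘-least    : ∀ x → 𝟘 ≤ x
    𝟙-greatest : ∀ x → x ≤ 𝟙
    ¬-involutive : ∀ x → ¬ (¬ x) ≡ x
    ¬-antitone   : ∀ x y → x ≤ y → ¬ y ≤ ¬ x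
    residuation₁ : ∀ x y z → x · y ≤ z → y ≤ x \\ z
    residuation₂ : ∀ x y z → y ≤ x \\ z → x · y ≤ z

-- Congruences of a residuated ortholattice: equivalence relations
-- compatible with all fundamental operations (constants are trivially
-- compatible).
record IsCongruence {a ℓ : Level} (A : ResiduatedOrtholattice a)
         (θ : Rel (ResiduatedOrtholattice.Carrier A) ℓ) : Set (a ⊔ ℓ) where
  open ResiduatedOrtholattice A
  field
    isEquivalence : IsEquivalence θ
    ∧-compat : ∀ {x x′ y y′} → θ x x′ → θ y y′ → θ (x ∧ y) (x′ ∧ y′)
    ∨-compat : ∀ {x x′ y y′} → θ x x′ → θ y y′ → θ (x ∨ y) (x′ ∨ y′)
    \\-compat : ∀ {x x′ y y′} → θ x x′ → θ y y′ → θ (x \\ y) (x′ \\ y′)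
    ¬-compat : ∀ {x x′} → θ x x′ → θ (¬ x) (¬ x′)

-- If x θ y then x \ y θ x \ x = 1, and symmetrically y \ x θ 1.  Conversely,
-- from x \ y ψ 1 we get x = x · 1 ψ x · (x \ y), and x · (x \ y) ≤ y by
-- residuation, so x ψ x · (x \ y) = x · (x \ y) ∧ y ψ x ∧ y; symmetrically
-- y ψ x ∧ y.
module Submission where

open import Defs
open import Level using (Level)
open import Relation.Binary.Core using (Rel)
open import Relation.Binary.PropositionalEquality using (_≡_; sym; trans; cong; subst; module ≡-Reasoning)
open import Relation.Binary.Structures using (IsEquivalence)
open import Function.Bundles using (_⇔_; mk⇔; Equivalence)
open import Algebra.Lattice.Bundles using (Lattice)
import Algebra.Lattice.Properties.Lattice as LatticeProperties

module ResiduatedOrtholatticeProperties {a : Level} (A : ResiduatedOrtholattice a) where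
  open ResiduatedOrtholattice A
  open ≡-Reasoning

  lattice : Lattice a a
  lattice = record { isLattice = isLattice }

  open Lattice lattice public using (∧-comm)
  open Lattice lattice using (∨-comm; ∨-absorbs-∧)
  open LatticeProperties lattice using (∧-idem)

  ≤-refl : ∀ x → x ≤ x
  ≤-refl = ∧-idem

  x∨𝟙≡𝟙 : ∀ x → x ∨ 𝟙 ≡ 𝟙
  x∨𝟙≡𝟙 x = begin
    x ∨ 𝟙        ≡⟨ ∨-comm x 𝟙 ⟩
    𝟙 ∨ x        ≡⟨ cong (𝟙 ∨_) (sym (trans (∧-comm 𝟙 x) (𝟙-greatest x))) ⟩
    𝟙 ∨ (𝟙 ∧ x)  ≡⟨ ∨-absorbs-∧ 𝟙 x ⟩
    𝟙            ∎

  x·𝟙≡x : ∀ x → x · 𝟙 ≡ x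
  x·𝟙≡x x = trans (cong (x ∧_) (x∨𝟙≡𝟙 (¬ x))) (𝟙-greatest x)

  𝟙≤x\\x : ∀ x → 𝟙 ≤ x \\ x
  𝟙≤x\\x x = residuation₁ x 𝟙 x (subst (_≤ x) (sym (x·𝟙≡x x)) (≤-refl x))

  x\\x≡𝟙 : ∀ x → x \\ x ≡ 𝟙
  x\\x≡𝟙 x = trans (sym (𝟙-greatest (x \\ x))) (trans (∧-comm (x \\ x) 𝟙) (𝟙≤x\\x x))

  x·[x\\y]≤y : ∀ x y → x · (x \\ y) ≤ y
  x·[x\\y]≤y x y = residuation₂ x (x \\ y) y (≤-refl (x \\ y))

module CongruenceProperties {a ℓ : Level} {A : ResiduatedOrtholattice a}
         {θ : Rel (ResiduatedOrtholattice.Carrier A) ℓ} (θ-cong : IsCongruence A θ) where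
  open ResiduatedOrtholattice A
  open ResiduatedOrtholatticeProperties A
  open IsCongruence θ-cong
  open IsEquivalence isEquivalence renaming (refl to θ-refl; sym to θ-sym; trans to θ-trans)

  related⇒\\∈[𝟙] : ∀ {x y} → θ x y → θ (x \\ y) 𝟙
  related⇒\\∈[𝟙] {x} θxy = subst (θ _) (x\\x≡𝟙 x) (\\-compat θ-refl (θ-sym θxy))

  \\∈[𝟙]⇒related-∧ : ∀ {x y} → θ (x \\ y) 𝟙 → θ x (x ∧ y)
  \\∈[𝟙]⇒related-∧ {x} {y} θ[x\\y]𝟙 =
    θ-trans x~u (subst (λ z → θ z (x ∧ y)) (x·[x\\y]≤y x y) (∧-compat (θ-sym x~u) θ-refl))
    where
    x~u : θ x (x · (x \\ y))
    x~u = subst (λ z → θ z (x · (x \\ y))) (x·𝟙≡x x)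
            (∧-compat θ-refl (∨-compat θ-refl (θ-sym θ[x\\y]𝟙)))

  \\-both∈[𝟙]⇒related : ∀ {x y} → θ (x \\ y) 𝟙 → θ (y \\ x) 𝟙 → θ x y
  \\-both∈[𝟙]⇒related {x} {y} θ[x\\y]𝟙 θ[y\\x]𝟙 =
    θ-trans (\\∈[𝟙]⇒related-∧ θ[x\\y]𝟙)
      (subst (λ z → θ z y) (∧-comm y x) (θ-sym (\\∈[𝟙]⇒related-∧ θ[y\\x]𝟙)))

module _ {a ℓ : Level} {A : ResiduatedOrtholattice a}
         {θ ψ : Rel (ResiduatedOrtholattice.Carrier A) ℓ}
         (θ-cong : IsCongruence A θ) (ψ-cong : IsCongruence A ψ) where
  open ResiduatedOrtholattice A using (𝟙)

  [𝟙]-⊆⇒⊆ : (∀ x → θ x 𝟙 → ψ x 𝟙) → ∀ x y → θ x y → ψ x y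
  [𝟙]-⊆⇒⊆ [𝟙]θ⊆[𝟙]ψ x y θxy =
    \\-both∈[𝟙]⇒related ([𝟙]θ⊆[𝟙]ψ _ (related⇒\\∈[𝟙] θxy))
                        ([𝟙]θ⊆[𝟙]ψ _ (related⇒\\∈[𝟙] (θ-sym θxy)))
    where
    open CongruenceProperties θ-cong using (related⇒\\∈[𝟙])
    open CongruenceProperties ψ-cong using (\\-both∈[𝟙]⇒related)
    open IsEquivalence (IsCongruence.isEquivalence θ-cong) renaming (sym to θ-sym)

lemma3p1 : {a ℓ : Level} (A : ResiduatedOrtholattice a)
    (θ ψ : Rel (ResiduatedOrtholattice.Carrier A) ℓ) →
    IsCongruence A θ → IsCongruence A ψ →
    (∀ x → θ x (ResiduatedOrtholattice.𝟙 A) ⇔ ψ x (ResiduatedOrtholattice.𝟙 A)) →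
    ∀ x y → θ x y ⇔ ψ x y
lemma3p1 A θ ψ θ-cong ψ-cong same-[𝟙] x y =
  mk⇔ ([𝟙]-⊆⇒⊆ θ-cong ψ-cong (λ z → Equivalence.to (same-[𝟙] z)) x y)
      ([𝟙]-⊆⇒⊆ ψ-cong θ-cong (λ z → Equivalence.from (same-[𝟙] z)) x y)
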